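{- Let $k\ge 4$ be an even integer. Suppose that, at some moment of an online Ramsey game, the host graph contains two vertex-disjoint blue paths $P$ and $Q$, each on $k/2$ vertices, and let $p$ be an endpoint of $P$ and $q$ an endpoint of $Q$. Then Builder can force, within $k$ rounds, a red $C_k$ or a blue path $R$ with endpoints $p$ and $q$ that contains at least $k/2$ vertices of $P\cup Q$.
   Context: Online Ramsey game: Builder and Painter play on the infinite complete graph $K_{\mathbb N}$ (possibly starting with some colored edges already on the board); in each round Builder selects a previously unselected edge and Painter colors it red or blue. The host graph is the colored graph formed by all edges colored so far. "Builder can force $F$ within $s$ rounds" means Builder has a strategy guaranteeing that after at most $s$ further rounds the host graph contains $F$ (here: contains one of the listed configurations), regardless of Painter's play. $C_k$ is the cycle on $k$ vertices; a red (blue) graph is one all of whose edges are red (blue). -}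

module Defs where

open import Data.Nat using (ℕ; zero; suc; _≤_; _≟_)
open import Data.Product using (Σ; _×_; _,_; proj₁; proj₂)
open import Data.Sum using (_⊎_)
open import Data.Unit using (⊤)
open import Data.Maybe using (Maybe; just)
open import Data.List using (List; []; _∷_; _++_; [_]; length; head; last; filter)
open import Data.List.Relation.Unary.Any using (Any)
open import Data.List.Relation.Unary.Unique.Propositional using (Unique)
open import Data.List.Relation.Unary.Linked using (Linked)
open import Data.List.Membership.Propositional using (_∈_)
open import Data.List.Membership.DecPropositional _≟_ using (_∈?_)
open import Relation.Binary.PropositionalEquality using (_≡_; _≢_)
open import Relation.Nullary using (¬_)

data Colour : Set where
  red blue : Colour

-- A coloured edge {u,v} of K_ℕ with its colour.
ColEdge : Set
ColEdge = ℕ × ℕ × Colour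

-- A board (host graph): the list of all edges coloured so far.
Board : Set
Board = List ColEdge

Selected : Board → ℕ → ℕ → Set
Selected B u v =
  Any (λ e → (proj₁ e ≡ u × proj₁ (proj₂ e) ≡ v) ⊎ (proj₁ e ≡ v × proj₁ (proj₂ e) ≡ u)) B

WF : Board → Set
WF [] = ⊤
WF ((u , v , c) ∷ B) = u ≢ v × ¬ Selected B u v × WF B

HasEdge : Board → Colour → ℕ → ℕ → Set
HasEdge B c u v = ((u , v , c) ∈ B) ⊎ ((v , u , c) ∈ B)

IsPath : Board → Colour → List ℕ → Set
IsPath B c vs = Unique vs × Linked (HasEdge B c) vs

HasCycle : Board → Colour → ℕ → Set
HasCycle B c k =
  Σ ℕ λ x → Σ (List ℕ) λ xs →
    length (x ∷ xs) ≡ k × Unique (x ∷ xs) × Linked (HasEdge B c) ((x ∷ xs) ++ [ x ])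

Endpoint : ℕ → List ℕ → Set
Endpoint p P = head P ≡ just p ⊎ last P ≡ just p

-- Builder can force the property Goal within s rounds from board B:
-- either Goal already holds, or Builder selects a new edge uv and,
-- whichever colour Painter chooses, Builder can force Goal within s-1 rounds.
data Forces (Goal : Board → Set) : ℕ → Board → Set where
  done : ∀ {s B} → Goal B → Forces Goal s B
  step : ∀ {s B} (u v : ℕ) → u ≢ v → ¬ Selected B u v →
         ((c : Colour) → Forces Goal s ((u , v , c) ∷ B)) →
         Forces Goal (suc s) B

countIn : List ℕ → List ℕ → ℕ
countIn S R = length (filter (λ x → x ∈? S) R)

Lemma8Goal : ℕ → ℕ → List ℕ → List ℕ → ℕ → ℕ → Board → Set
Lemma8Goal k m P Q p q B =
  HasCycle B red k ⊎
  (Σ (List ℕ) λ R → IsPath B blue R × head R ≡ just p × last R ≡ just q ×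
                    m ≤ countIn (P ++ Q) R)

-- Write the two blue paths as a₁ … a_m, starting at p, and c₁ … c_m, ending at q
-- (reversing P or Q if necessary). Builder offers, one by one, the edges of the
-- 2m-cycle c₁ a₁ c₂ a₂ … c_m a_m c₁ (edges that are already coloured cost nothing).
-- If Painter colours all of them red, they form a red C_k. Otherwise some blue edge
-- a_i c_j has j ≤ i + 1 (for the closing edge a_m c₁, j = 1), and then
-- a₁ … a_i c_j … c_m is a blue path from p to q with i + (m − j + 1) ≥ m vertices,
-- all in P ∪ Q.

module Submission where

open import Defs
open import Data.Nat using (ℕ; suc; _≤_; _*_; _+_; _≟_; z≤n; s≤s)
open import Data.Nat.Properties using (+-suc; +-comm; +-identityʳ; +-monoˡ-≤; suc-injective; module ≤-Reasoning)
open import Data.List using (List; []; _∷_; _++_; [_]; length; head; last; reverse; _ʳ++_)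
open import Data.List.Properties using (length-++; filter-all)
open import Data.List.Relation.Unary.All as All using (All; _∷_)
import Data.List.Relation.Unary.All.Properties as All
open import Data.List.Relation.Unary.AllPairs using (AllPairs; []; _∷_)
open import Data.List.Relation.Unary.Any using (Any; here; there; any?)
open import Data.List.Relation.Unary.Linked as Linked using (Linked; []; [-]; _∷_)
open import Data.List.Relation.Unary.Linked.Properties using (AllPairs⇒Linked)
open import Data.List.Relation.Unary.Unique.Propositional using (Unique)
import Data.List.Relation.Unary.Unique.Propositional.Properties as Unique
open import Data.List.Relation.Binary.Disjoint.Propositional using (Disjoint)
import Data.List.Relation.Binary.Disjoint.Propositional.Properties as Disjoint
open import Data.List.Relation.Binary.Subset.Propositional using (_⊆_)
open import Data.List.Relation.Binary.Subset.Propositional.Properties using (⊆-reflexive-↭)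
import Data.List.Relation.Binary.Subset.Propositional.Properties as Subset
open import Data.List.Relation.Binary.Permutation.Propositional using (_↭_; prep; ↭-refl; ↭-sym; ↭-trans; ↭⇒↭ₛ)
open import Data.List.Relation.Binary.Permutation.Propositional.Properties using (shift; ∷↭∷ʳ; ↭-length; ↭-reverse)
import Data.List.Relation.Binary.Permutation.Setoid.Properties as PermutationSetoid
open import Data.List.Membership.Propositional using (_∈_; _∉_; find)
open import Data.List.Membership.Propositional.Properties using (∈-++⁺ˡ; ∈-++⁺ʳ; ∈-++⁻; ∈-∃++)
open import Data.List.Membership.DecPropositional _≟_ using (_∈?_)
open import Data.Product using (Σ; ∃-syntax; _×_; _,_; proj₁)
open import Data.Sum using (_⊎_; inj₁; inj₂)
import Data.Sum as Sum
open import Data.Maybe using (just)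
open import Function using (id; _∘_)
open import Relation.Binary.Definitions using (Symmetric)
open import Relation.Nullary using (Dec; yes; no)
open import Relation.Nullary.Decidable using (_×-dec_; _⊎-dec_)
open import Relation.Binary.PropositionalEquality using (_≡_; _≢_; refl; sym; trans; cong; cong₂; subst; subst₂; setoid; module ≡-Reasoning)

private
  variable
    V : Set
    R : V → V → Set

data AnyAdjacent {V : Set} (R : V → V → Set) : List V → Set where
  here  : ∀ {x y zs} → R x y → AnyAdjacent R (x ∷ y ∷ zs)
  there : ∀ {x y zs} → AnyAdjacent R (y ∷ zs) → AnyAdjacent R (x ∷ y ∷ zs)

interleave : List V → List V → List V
interleave []       _        = []
interleave (_ ∷ _)  []       = []
interleave (x ∷ xs) (y ∷ ys) = x ∷ y ∷ interleave xs ys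

interleave-↭ : (xs ys : List V) → length xs ≡ length ys → interleave xs ys ↭ xs ++ ys
interleave-↭ []       []       _  = ↭-refl
interleave-↭ (x ∷ xs) (y ∷ ys) eq =
  prep x (↭-trans (prep y (interleave-↭ xs ys (suc-injective eq))) (↭-sym (shift y xs ys)))

Unique-resp-↭ : {xs ys : List V} → xs ↭ ys → Unique xs → Unique ys
Unique-resp-↭ xs↭ys = PermutationSetoid.Unique-resp-↭ (setoid _) (↭⇒↭ₛ xs↭ys)

closed-walk-≢ : {x y : V} {ys : List V} → Unique (x ∷ y ∷ ys) → Linked _≢_ (x ∷ y ∷ ys ++ [ x ])
closed-walk-≢ {x = x} {y} {ys} u@(x∉ ∷ _) =
  All.head x∉ ∷ AllPairs⇒Linked (Unique-resp-↭ (∷↭∷ʳ x (y ∷ ys)) u)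

AllPairs-++⁻ʳ : (xs : List V) {ys : List V} → AllPairs R (xs ++ ys) → AllPairs R ys
AllPairs-++⁻ʳ []       p       = p
AllPairs-++⁻ʳ (x ∷ xs) (_ ∷ p) = AllPairs-++⁻ʳ xs p

Linked-++⁻ʳ : (xs : List V) {ys : List V} → Linked R (xs ++ ys) → Linked R ys
Linked-++⁻ʳ []       l = l
Linked-++⁻ʳ (x ∷ xs) l = Linked-++⁻ʳ xs (Linked.tail l)

All-splice : {P : V → Set} (xs : List V) {x y : V} {xs′ ys : List V} →
             All P (xs ++ x ∷ xs′) → All P (y ∷ ys) → All P (xs ++ x ∷ y ∷ ys)
All-splice xs p q = All.++⁺ (All.++⁻ˡ xs p) (All.head (All.++⁻ʳ xs p) ∷ q)

AllPairs-splice : (xs : List V) {x y : V} {xs′ ys : List V} →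
                  AllPairs R (xs ++ x ∷ xs′) → AllPairs R (y ∷ ys) →
                  (∀ {u v} → u ∈ xs ++ x ∷ xs′ → v ∈ y ∷ ys → R u v) →
                  AllPairs R (xs ++ x ∷ y ∷ ys)
AllPairs-splice []       (_ ∷ _)  q cross = All.tabulate (cross (here refl)) ∷ q
AllPairs-splice (w ∷ xs) (pw ∷ p) q cross =
  All-splice xs pw (All.tabulate (cross (here refl))) ∷ AllPairs-splice xs p q (λ u∈ → cross (there u∈))

Linked-splice : (xs : List V) {x y : V} {xs′ ys : List V} →
                Linked R (xs ++ x ∷ xs′) → R x y → Linked R (y ∷ ys) → Linked R (xs ++ x ∷ y ∷ ys)
Linked-splice []            _         r l = r ∷ l
Linked-splice (w ∷ [])      (r₀ ∷ _)  r l = r₀ ∷ r ∷ l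
Linked-splice (w ∷ w′ ∷ xs) (r₀ ∷ l₀) r l = r₀ ∷ Linked-splice (w′ ∷ xs) l₀ r l

head-++-∷ : (xs : List V) {x : V} {ys zs : List V} → head (xs ++ x ∷ ys) ≡ head (xs ++ x ∷ zs)
head-++-∷ []      = refl
head-++-∷ (_ ∷ _) = refl

last-++-∷ : (xs : List V) {y : V} {ys : List V} → last (xs ++ y ∷ ys) ≡ last (y ∷ ys)
last-++-∷ []           = refl
last-++-∷ (_ ∷ [])     = refl
last-++-∷ (_ ∷ x ∷ xs) = last-++-∷ (x ∷ xs)

Linked-ʳ++ : Symmetric R →
             {x : V} {xs ys : List V} → Linked R (x ∷ xs) → Linked R (x ∷ ys) → Linked R (xs ʳ++ x ∷ ys)
Linked-ʳ++ R-sym [-]     l′ = l′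
Linked-ʳ++ R-sym (r ∷ l) l′ = Linked-ʳ++ R-sym l (R-sym r ∷ l′)

Linked-reverse : Symmetric R → {xs : List V} → Linked R xs → Linked R (reverse xs)
Linked-reverse R-sym {[]}    [] = []
Linked-reverse R-sym {_ ∷ _} l  = Linked-ʳ++ R-sym l [-]

head-ʳ++ : (xs : List V) {y : V} {ys : List V} → head (xs ʳ++ y ∷ ys) ≡ last (y ∷ xs)
head-ʳ++ []       = refl
head-ʳ++ (x ∷ xs) = head-ʳ++ xs

last-ʳ++ : (xs : List V) {y : V} {ys : List V} → last (xs ʳ++ y ∷ ys) ≡ last (y ∷ ys)
last-ʳ++ []       = refl
last-ʳ++ (x ∷ xs) = last-ʳ++ xs

head-reverse : (xs : List V) → head (reverse xs) ≡ last xs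
head-reverse []       = refl
head-reverse (x ∷ xs) = head-ʳ++ xs

last-reverse : (xs : List V) → last (reverse xs) ≡ head xs
last-reverse []       = refl
last-reverse (x ∷ xs) = last-ʳ++ xs

record Bridge {V : Set} (R : V → V → Set) (xs ys : List V) : Set where
  constructor bridge
  field
    xs₁ xs₂ ys₁ ys₂ : List V
    x y             : V
    xs-split        : xs ≡ xs₁ ++ x ∷ xs₂
    ys-split        : ys ≡ ys₁ ++ y ∷ ys₂
    edge            : R x y
    reach           : length ys₁ ≤ suc (length xs₁)

Bridge-∷ : {x y : V} {xs ys : List V} → Bridge R xs ys → Bridge R (x ∷ xs) (y ∷ ys)
Bridge-∷ {x = x} {y} (bridge xs₁ xs₂ ys₁ ys₂ x′ y′ refl refl r reach) =
  bridge (x ∷ xs₁) xs₂ (y ∷ ys₁) ys₂ x′ y′ refl refl r (s≤s reach)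

Bridge-to-head : {xs : List V} {y : V} {ys : List V} →
                 Any (λ x → R x y) xs → Bridge R xs (y ∷ ys)
Bridge-to-head {ys = ys} any with find any
... | x , x∈xs , r with ∈-∃++ x∈xs
...   | xs₁ , xs₂ , split = bridge xs₁ xs₂ [] ys x _ split refl r z≤n

interleave-bridge : Symmetric R → (ys xs : List V) {z : V} →
                    length ys ≡ length xs → AnyAdjacent R (interleave ys xs ++ [ z ]) →
                    Bridge R xs ys ⊎ Any (λ x → R x z) xs
interleave-bridge R-sym (y ∷ ys) (x ∷ xs) _ (here r) =
  inj₁ (bridge [] xs [] ys x y refl refl (R-sym r) z≤n)
interleave-bridge R-sym (y ∷ []) (x ∷ []) _ (there (here r)) = inj₂ (here r)
interleave-bridge R-sym (y ∷ y′ ∷ ys) (x ∷ x′ ∷ xs) _ (there (here r)) =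
  inj₁ (bridge [] (x′ ∷ xs) [ y ] ys x y′ refl refl r (s≤s z≤n))
interleave-bridge R-sym (y ∷ []) (x ∷ []) _ (there (there ()))
interleave-bridge R-sym (y ∷ ys@(_ ∷ _)) (x ∷ xs@(_ ∷ _)) eq (there (there adj)) =
  Sum.map Bridge-∷ there (interleave-bridge R-sym ys xs (suc-injective eq) adj)

HasEdge-sym : {B : Board} {c : Colour} → Symmetric (HasEdge B c)
HasEdge-sym = Sum.swap

HasEdge-mono : {B B′ : Board} {c : Colour} {u v : ℕ} → B ⊆ B′ → HasEdge B c u v → HasEdge B′ c u v
HasEdge-mono B⊆B′ (inj₁ e∈B) = inj₁ (B⊆B′ e∈B)
HasEdge-mono B⊆B′ (inj₂ e∈B) = inj₂ (B⊆B′ e∈B)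

IsPath-mono : {B B′ : Board} {c : Colour} {vs : List ℕ} → B ⊆ B′ → IsPath B c vs → IsPath B′ c vs
IsPath-mono B⊆B′ (u , l) = u , Linked.map (HasEdge-mono B⊆B′) l

IsPath-reverse : {B : Board} {c : Colour} {vs : List ℕ} → IsPath B c vs → IsPath B c (reverse vs)
IsPath-reverse {vs = vs} (u , l) = Unique-resp-↭ (↭-sym (↭-reverse vs)) u , Linked-reverse HasEdge-sym l

Selected? : (B : Board) (u v : ℕ) → Dec (Selected B u v)
Selected? B u v = any? (λ (x , y , _) → ((x ≟ u) ×-dec (y ≟ v)) ⊎-dec ((x ≟ v) ×-dec (y ≟ u))) B

Selected⇒HasEdge : {B : Board} {u v : ℕ} → Selected B u v → Σ Colour λ c → HasEdge B c u v
Selected⇒HasEdge sel with find sel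
... | (_ , _ , c) , e∈B , inj₁ (refl , refl) = c , inj₁ e∈B
... | (_ , _ , c) , e∈B , inj₂ (refl , refl) = c , inj₂ e∈B

Forces-map : {G H : Board → Set} → (∀ {B} → G B → H B) → {s : ℕ} {B : Board} → Forces G s B → Forces H s B
Forces-map G⇒H (done g)                      = done (G⇒H g)
Forces-map G⇒H (step u v u≢v fresh strategy) = step u v u≢v fresh (λ c → Forces-map G⇒H (strategy c))

Forces-suc : {G : Board → Set} {s : ℕ} {B : Board} → Forces G s B → Forces G (suc s) B
Forces-suc (done g)                      = done g
Forces-suc (step u v u≢v fresh strategy) = step u v u≢v fresh (λ c → Forces-suc (strategy c))

Forces-extends : {G : Board → Set} {s : ℕ} {B : Board} → Forces G s B → Forces (λ B′ → B ⊆ B′ × G B′) s B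
Forces-extends (done g)                      = done (id , g)
Forces-extends (step u v u≢v fresh strategy) =
  step u v u≢v fresh λ c →
    Forces-map (λ (sub , g) → (λ e∈B → sub (there e∈B)) , g) (Forces-extends (strategy c))

RedWalkOrBlueStep : List ℕ → Board → Set
RedWalkOrBlueStep w B = Linked (HasEdge B red) w ⊎ AnyAdjacent (HasEdge B blue) w

RedWalkOrBlueStep-∷ : {x y : ℕ} {ys : List ℕ} {s : ℕ} {B : Board} → HasEdge B red x y →
                      Forces (RedWalkOrBlueStep (y ∷ ys)) s B → Forces (RedWalkOrBlueStep (x ∷ y ∷ ys)) s B
RedWalkOrBlueStep-∷ {x} {y} {ys} {B = B} xy-red = Forces-map prepend ∘ Forces-extends
  where
  prepend : ∀ {B′} → B ⊆ B′ × RedWalkOrBlueStep (y ∷ ys) B′ → RedWalkOrBlueStep (x ∷ y ∷ ys) B′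
  prepend (sub , inj₁ red-walk)  = inj₁ (HasEdge-mono sub xy-red ∷ red-walk)
  prepend (_   , inj₂ blue-step) = inj₂ (there blue-step)

probe-walk : {B : Board} (x : ℕ) (xs : List ℕ) → Linked _≢_ (x ∷ xs) →
             Forces (RedWalkOrBlueStep (x ∷ xs)) (length xs) B
probe-walk x []       _                = done (inj₁ [-])
probe-walk {B} x (y ∷ ys) (x≢y ∷ distinct) with Selected? B x y
... | no fresh = step x y x≢y fresh λ
  { red  → RedWalkOrBlueStep-∷ (inj₁ (here refl)) (probe-walk y ys distinct)
  ; blue → done (inj₂ (here (inj₁ (here refl)))) }
... | yes selected with Selected⇒HasEdge selected
...   | blue , xy-blue = done (inj₂ (here xy-blue))
...   | red  , xy-red  = Forces-suc (RedWalkOrBlueStep-∷ xy-red (probe-walk y ys distinct))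

RedCycleOrBlueEdge : ℕ → List ℕ → Board → Set
RedCycleOrBlueEdge x xs B = HasCycle B red (length (x ∷ xs)) ⊎ AnyAdjacent (HasEdge B blue) (x ∷ xs ++ [ x ])

probe-cycle : {B : Board} (x y : ℕ) (ys : List ℕ) → Unique (x ∷ y ∷ ys) →
              Forces (RedCycleOrBlueEdge x (y ∷ ys)) (length (x ∷ y ∷ ys)) B
probe-cycle {B} x y ys u =
  subst (λ s → Forces (RedCycleOrBlueEdge x (y ∷ ys)) s B) rounds
        (Forces-map close (probe-walk x (y ∷ ys ++ [ x ]) (closed-walk-≢ u)))
  where
  rounds : length (y ∷ ys ++ [ x ]) ≡ length (x ∷ y ∷ ys)
  rounds = ↭-length (↭-sym (∷↭∷ʳ x (y ∷ ys)))
  close : ∀ {B′} → RedWalkOrBlueStep (x ∷ y ∷ ys ++ [ x ]) B′ → RedCycleOrBlueEdge x (y ∷ ys) B′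
  close (inj₁ red-cycle) = inj₁ (x , y ∷ ys , refl , u , red-cycle)
  close (inj₂ blue-step) = inj₂ blue-step

JoiningPath : Board → List ℕ → List ℕ → Set
JoiningPath B A C =
  Σ (List ℕ) λ R → IsPath B blue R × head R ≡ head A × last R ≡ last C × R ⊆ A ++ C × length C ≤ length R

splice-length : (xs ys₁ ys₂ : List ℕ) {x y y′ : ℕ} → length ys₁ ≤ suc (length xs) →
                length (ys₁ ++ y′ ∷ ys₂) ≤ length (xs ++ x ∷ y ∷ ys₂)
splice-length xs ys₁ ys₂ reach = begin
  length (ys₁ ++ _ ∷ ys₂)            ≡⟨ length-++ ys₁ ⟩
  length ys₁ + suc (length ys₂)      ≤⟨ +-monoˡ-≤ (suc (length ys₂)) reach ⟩
  suc (length xs) + suc (length ys₂) ≡⟨ sym (+-suc (length xs) (suc (length ys₂))) ⟩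
  length xs + suc (suc (length ys₂)) ≡⟨ sym (length-++ xs) ⟩
  length (xs ++ _ ∷ _ ∷ ys₂)         ∎
  where open ≤-Reasoning

splice-⊆ : (xs xs′ ys ys′ : List ℕ) {x y : ℕ} → xs ++ x ∷ y ∷ ys ⊆ (xs ++ x ∷ xs′) ++ (ys′ ++ y ∷ ys)
splice-⊆ xs xs′ ys ys′ v∈ with ∈-++⁻ xs v∈
... | inj₁ v∈xs          = ∈-++⁺ˡ (∈-++⁺ˡ v∈xs)
... | inj₂ (here refl)   = ∈-++⁺ˡ (∈-++⁺ʳ xs (here refl))
... | inj₂ (there v∈y∷ys) = ∈-++⁺ʳ (xs ++ _ ∷ xs′) (∈-++⁺ʳ ys′ v∈y∷ys)

bridge-joins : {B : Board} {A C : List ℕ} → IsPath B blue A → IsPath B blue C → Disjoint A C →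
               Bridge (HasEdge B blue) A C → JoiningPath B A C
bridge-joins (uA , lA) (uC , lC) A#C (bridge A₁ A₂ C₁ C₂ a c refl refl ac-blue reach) =
  A₁ ++ a ∷ c ∷ C₂ ,
  (AllPairs-splice A₁ uA (AllPairs-++⁻ʳ C₁ uC)
     (λ u∈A v∈C u≡v → A#C (u∈A , subst (_∈ _) (sym u≡v) (∈-++⁺ʳ C₁ v∈C))) ,
   Linked-splice A₁ lA ac-blue (Linked-++⁻ʳ C₁ lC)) ,
  head-++-∷ A₁ ,
  trans (last-++-∷ A₁) (sym (last-++-∷ C₁)) ,
  splice-⊆ A₁ A₂ C₂ C₁ ,
  splice-length A₁ C₁ C₂ reach

zigzag : {B : Board} (A C : List ℕ) → IsPath B blue A → IsPath B blue C → Disjoint A C → length A ≡ length C →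
         Forces (λ B′ → HasCycle B′ red (length A + length C) ⊎ JoiningPath B′ A C) (length A + length C) B
zigzag [] [] _ _ _ _ = done (inj₂ ([] , ([] , []) , refl , refl , (λ ()) , z≤n))
zigzag {B} (a ∷ A) (c ∷ C) pathA pathC A#C |A|≡|C| =
  subst (λ s → Forces goal s B) rounds
        (Forces-map outcome (Forces-extends (probe-cycle c a (interleave C A) cycle)))
  where
  goal : Board → Set
  goal B′ = HasCycle B′ red (length (a ∷ A) + length (c ∷ C)) ⊎ JoiningPath B′ (a ∷ A) (c ∷ C)
  interleaving : interleave (c ∷ C) (a ∷ A) ↭ (c ∷ C) ++ (a ∷ A)
  interleaving = interleave-↭ (c ∷ C) (a ∷ A) (sym |A|≡|C|)
  cycle : Unique (interleave (c ∷ C) (a ∷ A))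
  cycle = Unique-resp-↭ (↭-sym interleaving) (Unique.++⁺ (proj₁ pathC) (proj₁ pathA) (Disjoint.sym A#C))
  rounds : length (interleave (c ∷ C) (a ∷ A)) ≡ length (a ∷ A) + length (c ∷ C)
  rounds = trans (↭-length interleaving)
                 (trans (length-++ (c ∷ C)) (+-comm (length (c ∷ C)) (length (a ∷ A))))
  outcome : ∀ {B′} → B ⊆ B′ × RedCycleOrBlueEdge c (a ∷ interleave C A) B′ → goal B′
  outcome (_   , inj₁ red-cycle) = inj₁ (subst (HasCycle _ red) rounds red-cycle)
  outcome (B⊆B′ , inj₂ blue-edge) =
    inj₂ (bridge-joins (IsPath-mono B⊆B′ pathA) (IsPath-mono B⊆B′ pathC) A#C
            (Sum.[ id , Bridge-to-head ]′
               (interleave-bridge HasEdge-sym (c ∷ C) (a ∷ A) (sym |A|≡|C|) blue-edge)))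

path-starting-at : {B : Board} {c : Colour} {P : List ℕ} {p : ℕ} → IsPath B c P → Endpoint p P →
                   ∃[ A ] A ↭ P × IsPath B c A × head A ≡ just p
path-starting-at {P = P} path (inj₁ starts-at-p) = P , ↭-refl , path , starts-at-p
path-starting-at {P = P} path (inj₂ ends-at-p)   =
  reverse P , ↭-reverse P , IsPath-reverse path , trans (head-reverse P) ends-at-p

path-ending-at : {B : Board} {c : Colour} {P : List ℕ} {p : ℕ} → IsPath B c P → Endpoint p P →
                 ∃[ A ] A ↭ P × IsPath B c A × last A ≡ just p
path-ending-at {P = P} path (inj₁ starts-at-p) =
  reverse P , ↭-reverse P , IsPath-reverse path , trans (last-reverse P) starts-at-p
path-ending-at {P = P} path (inj₂ ends-at-p)   = P , ↭-refl , path , ends-at-p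

countIn-⊆ : {S R : List ℕ} → R ⊆ S → countIn S R ≡ length R
countIn-⊆ {S} R⊆S = cong length (filter-all (_∈? S) (All.tabulate R⊆S))

lemma8 : (k m : ℕ) → 4 ≤ k → k ≡ 2 * m →
    (B : Board) → WF B →
    (P Q : List ℕ) →
    IsPath B blue P → IsPath B blue Q →
    length P ≡ m → length Q ≡ m →
    All (λ x → x ∉ Q) P →
    (p q : ℕ) → Endpoint p P → Endpoint q Q →
    Forces (Lemma8Goal k m P Q p q) k B
lemma8 k m _ k≡2m B _ P Q pathP pathQ |P|≡m |Q|≡m P∉Q p q p-end q-end
  with path-starting-at pathP p-end | path-ending-at pathQ q-end
... | A , A↭P , pathA , A-starts-at-p | C , C↭Q , pathC , C-ends-at-q =
  subst (λ s → Forces (Lemma8Goal k m P Q p q) s B) rounds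
        (Forces-map outcome (zigzag A C pathA pathC A#C (trans |A|≡m (sym |C|≡m))))
  where
  |A|≡m : length A ≡ m
  |A|≡m = trans (↭-length A↭P) |P|≡m
  |C|≡m : length C ≡ m
  |C|≡m = trans (↭-length C↭Q) |Q|≡m
  A#C : Disjoint A C
  A#C (v∈A , v∈C) = All.lookup P∉Q (⊆-reflexive-↭ A↭P v∈A) (⊆-reflexive-↭ C↭Q v∈C)
  rounds : length A + length C ≡ k
  rounds = begin
    length A + length C ≡⟨ cong₂ _+_ |A|≡m |C|≡m ⟩
    m + m               ≡⟨ cong (m +_) (sym (+-identityʳ m)) ⟩
    2 * m               ≡⟨ sym k≡2m ⟩
    k                   ∎
    where open ≡-Reasoning
  outcome : ∀ {B′} → HasCycle B′ red (length A + length C) ⊎ JoiningPath B′ A C → Lemma8Goal k m P Q p q B′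
  outcome (inj₁ red-cycle) = inj₁ (subst (HasCycle _ red) rounds red-cycle)
  outcome (inj₂ (R , pathR , R-start , R-end , R⊆A++C , |C|≤|R|)) =
    inj₂ (R , pathR , trans R-start A-starts-at-p , trans R-end C-ends-at-q ,
          subst₂ _≤_ |C|≡m (sym (countIn-⊆ R⊆P++Q)) |C|≤|R|)
    where
    R⊆P++Q : R ⊆ P ++ Q
    R⊆P++Q = Subset.++⁺ (⊆-reflexive-↭ A↭P) (⊆-reflexive-↭ C↭Q) ∘ R⊆A++C
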